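{- Let $n$ be an even positive integer. The fractions $n/d$ with numerator $n$ and odd positive denominator $d$ whose odd greedy expansion has length $2$ are exactly those of the form \[ \frac{n}{n\bigl(\prod_{i=1}^s p_i^{a_i}\bigr)(1+2t)-r}, \] where $r$ is any odd positive integer less than $2n$, $p_1,\dotsc,p_s$ are the (distinct) prime divisors of $r$ (the product being $1$ if $r=1$), $t$ is any nonnegative integer, and \[ a_i=\max\Bigl\{\Bigl\lceil \frac{v_{p_i}(r)-v_{p_i}(n)}{2}\Bigr\rceil,0\Bigr\}. \]
   Context: Odd greedy expansion: given a positive rational $q$, define $x_1,x_2,\dots$ recursively: writing $R_i=q-\sum_{j=1}^{i-1}1/x_j$, if $R_i\ge1$ let $x_i=1$, and if $0<R_i<1$ let $x_i$ be the unique odd positive integer with $\frac1{x_i}\le R_i<\frac1{x_i-2}$; stop when the remainder is $0$. The number of terms is the length. For a prime $p$ and nonzero integer $n$, $v_p(n)$ is the exponent of the largest power of $p$ dividing $n$. -}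

module Defs where

open import Data.Nat as ℕ using (ℕ; zero; suc; _+_; _*_; _∸_; _^_; NonZero)
open import Data.Nat.Divisibility using (_∣?_)
open import Data.Nat.Primality using (prime?)
open import Data.List using (List; map; upTo)
open import Data.Nat.ListAction using (product)
open import Data.Bool using (if_then_else_; _∧_)
open import Data.Product using (∃; _×_)
open import Data.Integer as ℤ using (ℤ; +_)
open import Data.Rational using (ℚ; _/_; _≤_; _<_; _-_; 0ℚ; 1ℚ)
open import Relation.Nullary using (does)
open import Relation.Binary.PropositionalEquality using (_≡_)

Even : ℕ → Set
Even n = ∃ λ k → n ≡ 2 * k

Odd : ℕ → Set
Odd n = ∃ λ k → n ≡ 1 + 2 * k

-- p-adic valuation v_p(m) (meaningful for p ≥ 2, m ≥ 1), computed with fuel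
valFuel : ℕ → ℕ → ℕ → ℕ
valFuel zero p m = 0
valFuel (suc f) zero m = 0
valFuel (suc f) (suc zero) m = 0
valFuel (suc f) (suc (suc q)) zero = 0
valFuel (suc f) (suc (suc q)) (suc m) with suc (suc q) ∣? suc m
... | Relation.Nullary.yes _ = suc (valFuel f (suc (suc q)) (suc m ℕ./ suc (suc q)))
... | Relation.Nullary.no _ = 0

v : ℕ → ℕ → ℕ
v p m = valFuel m p m

-- exponent a_p = max(⌈(v_p(r) - v_p(n))/2⌉, 0) = ⌊((v_p(r) ∸ v_p(n)) + 1) / 2⌋
expo : ℕ → ℕ → ℕ → ℕ
expo n r p = ((v p r ∸ v p n) + 1) ℕ./ 2

primeProd : ℕ → ℕ → ℕ
primeProd n r =
  product (map (λ p → if does (prime? p) ∧ does (p ∣? r) then p ^ expo n r p else 1)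
               (upTo (suc r)))

data GreedyStep (R : ℚ) : ℚ → Set where
  big   : 1ℚ ≤ R → GreedyStep R (R - 1ℚ)
  -- 0 < R < 1 : x = 2k+3 is the unique odd integer with 1/x ≤ R < 1/(x-2)
  small : (k : ℕ) → 0ℚ < R → R < 1ℚ →
          (+ 1 / (3 + 2 * k)) ≤ R → R < (+ 1 / (1 + 2 * k)) →
          GreedyStep R (R - (+ 1 / (3 + 2 * k)))

data OGLength : ℚ → ℕ → Set where
  done : OGLength 0ℚ 0
  step : ∀ {R R' ℓ} → 0ℚ < R → GreedyStep R R' → OGLength R' ℓ → OGLength R (suc ℓ)

module Submission where

-- The first odd greedy denominator of n/d is the odd x with d ≤ nx < d + 2n, and the
-- expansion stops after two terms exactly when the remainder n/d − 1/x = r/(dx), where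
-- r = nx − d, is a unit fraction, i.e. when r ∣ dx, i.e. when r ∣ nx². As n is even and
-- d is odd, r is odd, and r < 2n. Comparing p-adic valuations, r ∣ nx² holds iff
-- v_p(r) ≤ v_p(n) + 2 v_p(x) for all p, iff p ^ a_p ∣ x for all p ∣ r, iff ∏ p ^ a_p ∣ x;
-- writing x = (∏ p ^ a_p)(1 + 2t) then gives d = nx − r.

open import Defs
open import Data.Bool using (if_then_else_; _∧_)
open import Data.Integer as ℤ using (ℤ; +_; _-_)
import Data.Integer.Properties as ℤP
open import Data.Integer.Tactic.RingSolver using (solve-∀)
open import Data.List using (map; upTo; []; _∷_)
open import Data.List.Membership.Propositional.Properties using (∈-map⁺; ∈-upTo⁺)
open import Data.List.Relation.Unary.All as All using (All; []; _∷_)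
import Data.List.Relation.Unary.All.Properties as All
open import Data.List.Relation.Unary.AllPairs using ([]; _∷_)
open import Data.List.Relation.Unary.Unique.Propositional using (Unique)
open import Data.List.Relation.Unary.Unique.Propositional.Properties using (upTo⁺)
import Data.Nat as ℕ
open import Data.Nat hiding (_/_)
open import Data.Nat.Divisibility
open import Data.Nat.DivMod using (m≡m%n+[m/n]*n; m%n<n; m<n*o⇒m/o<n; m/n<m; m≥n⇒m/n>0; m*[n/m]≡n)
open import Data.Nat.Induction using (<-rec)
open import Data.Nat.ListAction using (product)
open import Data.Nat.ListAction.Properties using (product≢0; ∈⇒∣product)
open import Data.Nat.Primality
open import Data.Nat.Primality.Factorisation using (factorise)
open import Data.Nat.Properties
open import Data.Product using (∃; ∃₂; _×_; _,_; proj₁; proj₂)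
open import Data.Product.Function.NonDependent.Propositional using (_×-⇔_)
open import Data.Rational as ℚ using (_/_; 0ℚ; 1ℚ; toℚᵘ)
import Data.Rational.Properties as ℚP
open import Data.Rational.Unnormalised as ℚᵘ using (mkℚᵘ; *≡*; *≤*; *<*) renaming (_≃_ to _≃ᵘ_)
import Data.Rational.Unnormalised.Properties as ℚᵘP
open import Data.Sum using (_⊎_; inj₁; inj₂; [_,_]′)
open import Function.Base using (_∘_; id)
open import Function.Bundles using (_⇔_; mk⇔; Equivalence)
import Function.Properties.Equivalence as ⇔
open import Function.Related.Propositional using (module EquationalReasoning)
open import Relation.Binary.PropositionalEquality
open import Relation.Nullary using (¬_; yes; no; does; contradiction)
open import Algebra.Properties.Group ℚP.+-0-group using (x∙y⁻¹≈ε⇒x≈y)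

2∤odd : ∀ {m} → Odd m → ¬ 2 ∣ m
2∤odd (k , refl) 2∣1+2k =
  contradiction (∣1⇒≡1 (∣m+n∣m⇒∣n (subst (2 ∣_) (+-comm 1 (2 * k)) 2∣1+2k) (m∣m*n k))) λ ()

odd⊎2∣ : ∀ m → Odd m ⊎ 2 ∣ m
odd⊎2∣ zero = inj₂ (divides 0 refl)
odd⊎2∣ (suc m) with odd⊎2∣ m
... | inj₁ (k , refl)       = inj₂ (divides (suc k) (cong (suc ∘ suc) (*-comm 2 k)))
... | inj₂ (divides k refl) = inj₁ (k , cong suc (*-comm k 2))

2∤⇒odd : ∀ {m} → ¬ 2 ∣ m → Odd m
2∤⇒odd {m} 2∤m with odd⊎2∣ m
... | inj₁ odd-m = odd-m
... | inj₂ 2∣m   = contradiction 2∣m 2∤m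

even⇒2∣ : ∀ {m} → Even m → 2 ∣ m
even⇒2∣ (k , refl) = m∣m*n k

odd⇒nonZero : ∀ {m} → Odd m → NonZero m
odd⇒nonZero (k , refl) = _

odd-* : ∀ {m n} → Odd m → Odd n → Odd (m * n)
odd-* {m} {n} odd-m odd-n = 2∤⇒odd ([ 2∤odd odd-m , 2∤odd odd-n ]′ ∘ euclidsLemma m n prime[2])

odd-*⇒oddˡ : ∀ m n → Odd (m * n) → Odd m
odd-*⇒oddˡ m n odd-mn = 2∤⇒odd λ 2∣m → 2∤odd odd-mn (∣m⇒∣m*n n 2∣m)

odd∧2∣+⇒odd : ∀ {m n} → Odd m → 2 ∣ m + n → Odd n
odd∧2∣+⇒odd {m} {n} odd-m 2∣m+n =
  2∤⇒odd λ 2∣n → 2∤odd odd-m (∣m+n∣m⇒∣n (subst (2 ∣_) (+-comm m n) 2∣m+n) 2∣n)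

-- p-adic valuations

^-monoʳ-∣ : ∀ m {n o} → n ≤ o → m ^ n ∣ m ^ o
^-monoʳ-∣ m {n} {o} n≤o = divides (m ^ (o ∸ n)) (begin
  m ^ o               ≡⟨ cong (m ^_) (m+[n∸m]≡n n≤o) ⟨
  m ^ (n + (o ∸ n))   ≡⟨ ^-distribˡ-+-* m n (o ∸ n) ⟩
  m ^ n * m ^ (o ∸ n) ≡⟨ *-comm (m ^ n) _ ⟩
  m ^ (o ∸ n) * m ^ n ∎)
  where open ≡-Reasoning

prime∣^⇒∣ : ∀ {q p} e → Prime q → q ∣ p ^ e → q ∣ p
prime∣^⇒∣ zero q-pr q∣1 = contradiction (subst Prime (∣1⇒≡1 q∣1) q-pr) ¬prime[1]
prime∣^⇒∣ {q} {p} (suc e) q-pr q∣p^[1+e] =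
  [ id , prime∣^⇒∣ e q-pr ]′ (euclidsLemma p (p ^ e) q-pr q∣p^[1+e])

prime∣prime⇒≡ : ∀ {q p} → Prime q → Prime p → q ∣ p → q ≡ p
prime∣prime⇒≡ q-pr p-pr q∣p =
  [ (λ q≡1 → contradiction (subst Prime q≡1 q-pr) ¬prime[1]) , id ]′ (prime⇒irreducible p-pr q∣p)

prime^∣*⇒∣ʳ : ∀ {p m n} k → Prime p → ¬ p ∣ m → p ^ k ∣ m * n → p ^ k ∣ n
prime^∣*⇒∣ʳ zero _ _ _ = 1∣ _
prime^∣*⇒∣ʳ {p} {m} {n} (suc k) p-pr p∤m p^[1+k]∣mn
  with euclidsLemma m n p-pr (∣-trans (m∣m*n (p ^ k)) p^[1+k]∣mn)
... | inj₁ p∣m = contradiction p∣m p∤m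
... | inj₂ (divides n′ refl) = subst (p * p ^ k ∣_) (*-comm p n′) (*-monoʳ-∣ p p^k∣n′)
  where
  instance
    p≢0 : NonZero p
    p≢0 = prime⇒nonZero p-pr
  p^k∣n′ : p ^ k ∣ n′
  p^k∣n′ = prime^∣*⇒∣ʳ k p-pr p∤m (*-cancelˡ-∣ p
    (subst (p * p ^ k ∣_) (trans (sym (*-assoc m n′ p)) (*-comm (m * n′) p)) p^[1+k]∣mn))

prime^∣^*⇒≤ : ∀ {p u j k} → Prime p → ¬ p ∣ u → p ^ j ∣ p ^ k * u → j ≤ k
prime^∣^*⇒≤ {p} {u} {j} {k} p-pr p∤u p^j∣p^ku with j ≤? k
... | yes j≤k = j≤k
... | no j≰k  = contradiction (*-cancelˡ-∣ (p ^ k) p^kp∣p^ku) p∤u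
  where
  instance
    p^k≢0 : NonZero (p ^ k)
    p^k≢0 = m^n≢0 p k {{prime⇒nonZero p-pr}}
  p^kp∣p^ku : p ^ k * p ∣ p ^ k * u
  p^kp∣p^ku = subst (_∣ p ^ k * u) (*-comm p (p ^ k)) (∣-trans (^-monoʳ-∣ p (≰⇒> j≰k)) p^j∣p^ku)

private
  valFuel-split : ∀ f q m → .{{_ : NonZero m}} → m ≤ f →
                  ∃ λ u → m ≡ (2 + q) ^ valFuel f (2 + q) m * u × ¬ 2 + q ∣ u
  valFuel-split (suc f) q (suc m) (s≤s m≤f) with 2 + q ∣? suc m
  ... | no p∤m = suc m , sym (+-identityʳ (suc m)) , p∤m
  ... | yes p∣m with valFuel-split f q (suc m ℕ./ (2 + q)) {{m/p≢0}} m/p≤f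
    where
    m/p≢0 : NonZero (suc m ℕ./ (2 + q))
    m/p≢0 = >-nonZero (m≥n⇒m/n>0 (∣⇒≤ p∣m))
    m/p≤f : suc m ℕ./ (2 + q) ≤ f
    m/p≤f = ≤-trans (s≤s⁻¹ (m/n<m (suc m) (2 + q) (s≤s (s≤s z≤n)))) m≤f
  ... | u , m/p≡p^vu , p∤u = u , m≡p^[1+v]u , p∤u
    where
    p : ℕ
    p = 2 + q
    m≡p^[1+v]u : suc m ≡ p ^ suc (valFuel f p (suc m ℕ./ p)) * u
    m≡p^[1+v]u = begin
      suc m                                     ≡⟨ m*[n/m]≡n p∣m ⟨
      p * (suc m ℕ./ p)                         ≡⟨ cong (p *_) m/p≡p^vu ⟩
      p * (p ^ valFuel f p (suc m ℕ./ p) * u)   ≡⟨ *-assoc p (p ^ valFuel f p (suc m ℕ./ p)) u ⟨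
      p ^ suc (valFuel f p (suc m ℕ./ p)) * u   ∎
      where open ≡-Reasoning

v-split : ∀ {p} → Prime p → ∀ m → .{{_ : NonZero m}} → ∃ λ u → m ≡ p ^ v p m * u × ¬ p ∣ u
v-split {2+ q} _ m = valFuel-split m q m ≤-refl

^v∣ : ∀ {p} → Prime p → ∀ m → .{{_ : NonZero m}} → p ^ v p m ∣ m
^v∣ {p} p-pr m with v-split p-pr m
... | u , m≡p^vu , _ = divides u (trans m≡p^vu (*-comm (p ^ v p m) u))

^∣⇒≤v : ∀ {p k} → Prime p → ∀ m → .{{_ : NonZero m}} → p ^ k ∣ m → k ≤ v p m
^∣⇒≤v {p} {k} p-pr m p^k∣m with v-split p-pr m
... | u , m≡p^vu , p∤u = prime^∣^*⇒≤ p-pr p∤u (subst (p ^ k ∣_) m≡p^vu p^k∣m)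

^∣⇔≤v : ∀ {p k} → Prime p → ∀ m → .{{_ : NonZero m}} → p ^ k ∣ m ⇔ k ≤ v p m
^∣⇔≤v {p} p-pr m = mk⇔ (^∣⇒≤v p-pr m) λ k≤v → ∣-trans (^-monoʳ-∣ p k≤v) (^v∣ p-pr m)

v-unique : ∀ {p e u} → Prime p → ∀ m → .{{_ : NonZero m}} → m ≡ p ^ e * u → ¬ p ∣ u → v p m ≡ e
v-unique {p} {e} {u} p-pr m m≡p^eu p∤u = ≤-antisym
  (prime^∣^*⇒≤ p-pr p∤u (subst (p ^ v p m ∣_) m≡p^eu (^v∣ p-pr m)))
  (^∣⇒≤v p-pr m (divides u (trans m≡p^eu (*-comm (p ^ e) u))))

v≡0 : ∀ {p} → Prime p → ∀ m → .{{_ : NonZero m}} → ¬ p ∣ m → v p m ≡ 0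
v≡0 p-pr m p∤m = v-unique p-pr m (sym (+-identityʳ m)) p∤m

v-* : ∀ {p} → Prime p → ∀ m n → .{{_ : NonZero m}} → .{{_ : NonZero n}} →
      v p (m * n) ≡ v p m + v p n
v-* {p} p-pr m n with v-split p-pr m | v-split p-pr n
... | u , m≡p^au , p∤u | w , n≡p^bw , p∤w =
  v-unique p-pr (m * n) {{m*n≢0 m n}} mn≡p^[a+b]uw ([ p∤u , p∤w ]′ ∘ euclidsLemma u w p-pr)
  where
  mn≡p^[a+b]uw : m * n ≡ p ^ (v p m + v p n) * (u * w)
  mn≡p^[a+b]uw = begin
    m * n                               ≡⟨ cong₂ _*_ m≡p^au n≡p^bw ⟩
    (p ^ v p m * u) * (p ^ v p n * w)   ≡⟨ [m*n]*[o*p]≡[m*o]*[n*p] (p ^ v p m) u (p ^ v p n) w ⟩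
    (p ^ v p m * p ^ v p n) * (u * w)   ≡⟨ cong (_* (u * w)) (^-distribˡ-+-* p (v p m) (v p n)) ⟨
    p ^ (v p m + v p n) * (u * w)       ∎
    where open ≡-Reasoning

primeDivisor : ∀ d → .{{_ : NonTrivial d}} → ∃ λ p → Prime p × p ∣ d
primeDivisor (2+ k) with factorise (2+ k)
... | record { factors = [] ; isFactorisation = () }
... | record { factors = p ∷ ps ; isFactorisation = d≡p*Πps ; factorsPrime = p-pr ∷ _ } =
  p , p-pr , divides (product ps) (trans d≡p*Πps (*-comm p (product ps)))

PrimePowersDivide : ℕ → ℕ → Set
PrimePowersDivide d N = ∀ {p} k → Prime p → p ^ k ∣ d → p ^ k ∣ N

-- Write d = p ^ v_p(d) * u for a prime p ∣ d; then u is a proper divisor of d coprime to p.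
∣-byPrimePowers : ∀ d {N} → .{{_ : NonZero d}} → PrimePowersDivide d N → d ∣ N
∣-byPrimePowers = <-rec (λ d → ∀ {N} → .{{_ : NonZero d}} → PrimePowersDivide d N → d ∣ N) go
  where
  go : ∀ d → (∀ {c} → c < d → ∀ {N} → .{{_ : NonZero c}} → PrimePowersDivide c N → c ∣ N) →
       ∀ {N} → .{{_ : NonZero d}} → PrimePowersDivide d N → d ∣ N
  go 1 _ _ = 1∣ _
  go d@(2+ _) ind d-ppd with primeDivisor d
  ... | p , p-pr , p∣d with v-split p-pr d
  ...   | u , d≡p^Vu , p∤u with ind u<d {{u≢0}} (λ k q-pr q^k∣u → d-ppd k q-pr (∣-trans q^k∣u u∣d))
    where
    u∣d : u ∣ d
    u∣d = divides (p ^ v p d) d≡p^Vu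
    u<d : u < d
    u<d = ≤∧≢⇒< (∣⇒≤ u∣d) λ u≡d → p∤u (subst (p ∣_) (sym u≡d) p∣d)
    u≢0 : NonZero u
    u≢0 = m*n≢0⇒n≢0 (p ^ v p d) {{subst NonZero d≡p^Vu _}}
  ...     | divides N′ refl = subst (_∣ N′ * u) (sym d≡p^Vu) (*-monoˡ-∣ u p^V∣N′)
    where
    p^V∣N′ : p ^ v p d ∣ N′
    p^V∣N′ = prime^∣*⇒∣ʳ (v p d) p-pr p∤u
      (subst (p ^ v p d ∣_) (*-comm N′ u) (d-ppd (v p d) p-pr (^v∣ p-pr d)))

PrimePowerValued : (ℕ → ℕ) → Set
PrimePowerValued f = ∀ p → f p ≡ 1 ⊎ (Prime p × ∃ λ e → f p ≡ p ^ e)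

module _ {f : ℕ → ℕ} (f-ppv : PrimePowerValued f) where

  ppv-nonZero : ∀ p → NonZero (f p)
  ppv-nonZero p with f-ppv p
  ... | inj₁ fp≡1                = subst NonZero (sym fp≡1) _
  ... | inj₂ (p-pr , e , fp≡p^e) = subst NonZero (sym fp≡p^e) (m^n≢0 p e {{prime⇒nonZero p-pr}})

  ppv-product-nonZero : ∀ ps → NonZero (product (map f ps))
  ppv-product-nonZero ps = product≢0 (All.map⁺ (All.universal ppv-nonZero ps))

  prime∤ppv : ∀ {q p} → Prime q → p ≢ q → ¬ q ∣ f p
  prime∤ppv {q} {p} q-pr p≢q q∣fp with f-ppv p
  ... | inj₁ fp≡1 = contradiction (subst Prime (∣1⇒≡1 (subst (q ∣_) fp≡1 q∣fp)) q-pr) ¬prime[1]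
  ... | inj₂ (p-pr , e , fp≡p^e) =
    p≢q (sym (prime∣prime⇒≡ q-pr p-pr (prime∣^⇒∣ e q-pr (subst (q ∣_) fp≡p^e q∣fp))))

  prime∤ppv-product : ∀ {q} ps → Prime q → All (_≢ q) ps → ¬ q ∣ product (map f ps)
  prime∤ppv-product [] q-pr [] q∣1 = contradiction (subst Prime (∣1⇒≡1 q∣1) q-pr) ¬prime[1]
  prime∤ppv-product (p ∷ ps) q-pr (p≢q ∷ ps≢q) =
    [ prime∤ppv q-pr p≢q , prime∤ppv-product ps q-pr ps≢q ]′ ∘ euclidsLemma (f p) _ q-pr

  prime^∣ppv-product⇒∣ : ∀ {q} k ps → Prime q → Unique ps →
                         q ^ k ∣ product (map f ps) → q ^ k ∣ f q
  prime^∣ppv-product⇒∣ k [] q-pr [] q^k∣1 = subst (_∣ f _) (sym (∣1⇒≡1 q^k∣1)) (1∣ _)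
  prime^∣ppv-product⇒∣ {q} k (p ∷ ps) q-pr (p∉ps ∷ ps-unique) q^k∣Π with p ≟ q
  ... | yes refl = prime^∣*⇒∣ʳ k q-pr (prime∤ppv-product ps q-pr (All.map (_∘ sym) p∉ps))
                     (subst (q ^ k ∣_) (*-comm (f q) _) q^k∣Π)
  ... | no p≢q = prime^∣ppv-product⇒∣ k ps q-pr ps-unique
                   (prime^∣*⇒∣ʳ k q-pr (prime∤ppv q-pr p≢q) q^k∣Π)

-- The product ∏ p ^ a_p

-- primeProd n r unfolds to product (map (primeProdFactor n r) (upTo (suc r))).
primeProdFactor : ℕ → ℕ → ℕ → ℕ
primeProdFactor n r p = if does (prime? p) ∧ does (p ∣? r) then p ^ expo n r p else 1

module _ (n r : ℕ) where

  primeProdFactor-ppv : PrimePowerValued (primeProdFactor n r)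
  primeProdFactor-ppv p with prime? p | p ∣? r
  ... | yes p-pr | yes _ = inj₂ (p-pr , expo n r p , refl)
  ... | yes _    | no _  = inj₁ refl
  ... | no _     | _     = inj₁ refl

  primeProdFactor∣^expo : ∀ p → primeProdFactor n r p ∣ p ^ expo n r p
  primeProdFactor∣^expo p with prime? p | p ∣? r
  ... | yes _ | yes _ = ∣-refl
  ... | yes _ | no _  = 1∣ _
  ... | no _  | _     = 1∣ _

  primeProdFactor≡^expo : ∀ {p} → Prime p → p ∣ r → primeProdFactor n r p ≡ p ^ expo n r p
  primeProdFactor≡^expo {p} p-pr p∣r with prime? p | p ∣? r
  ... | yes _    | yes _  = refl
  ... | yes _    | no p∤r = contradiction p∣r p∤r
  ... | no ¬p-pr | _      = contradiction p-pr ¬p-pr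

  expo≡0 : ∀ {p} → Prime p → .{{_ : NonZero r}} → ¬ p ∣ r → expo n r p ≡ 0
  expo≡0 {p} p-pr p∤r = begin
    (v p r ∸ v p n + 1) ℕ./ 2 ≡⟨ cong (λ a → (a ∸ v p n + 1) ℕ./ 2) (v≡0 p-pr r p∤r) ⟩
    (0 ∸ v p n + 1) ℕ./ 2     ≡⟨ cong (λ a → (a + 1) ℕ./ 2) (0∸n≡0 (v p n)) ⟩
    0                         ∎
    where open ≡-Reasoning

  ^expo∣primeProd : ∀ {p} → Prime p → .{{_ : NonZero r}} → p ^ expo n r p ∣ primeProd n r
  ^expo∣primeProd {p} p-pr with p ∣? r
  ... | yes p∣r = subst (_∣ primeProd n r) (primeProdFactor≡^expo p-pr p∣r)
                    (∈⇒∣product (∈-map⁺ (primeProdFactor n r) (∈-upTo⁺ (s≤s (∣⇒≤ p∣r)))))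
  ... | no p∤r  = subst (λ e → p ^ e ∣ primeProd n r) (sym (expo≡0 p-pr p∤r)) (1∣ _)

  prime^∣primeProd⇒∣^expo : ∀ {p} k → Prime p → p ^ k ∣ primeProd n r → p ^ k ∣ p ^ expo n r p
  prime^∣primeProd⇒∣^expo k p-pr p^k∣Π = ∣-trans
    (prime^∣ppv-product⇒∣ primeProdFactor-ppv k (upTo (suc r)) p-pr (upTo⁺ (suc r)) p^k∣Π)
    (primeProdFactor∣^expo _)

  primeProd-nonZero : NonZero (primeProd n r)
  primeProd-nonZero = ppv-product-nonZero primeProdFactor-ppv (upTo (suc r))

primeProd-odd : ∀ n {r} → Odd r → Odd (primeProd n r)
primeProd-odd n {r} odd-r = 2∤⇒odd λ 2∣Π → 2∤odd (0 , refl)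
  (subst (λ e → 2 ∣ 2 ^ e) (expo≡0 n r prime[2] {{odd⇒nonZero odd-r}} (2∤odd odd-r))
    (prime^∣primeProd⇒∣^expo n r 1 prime[2] 2∣Π))

[m∸n+1]/2≤o⇔m≤n+[o+o] : ∀ m n o → (m ∸ n + 1) ℕ./ 2 ≤ o ⇔ m ≤ n + (o + o)
[m∸n+1]/2≤o⇔m≤n+[o+o] m n o = mk⇔ (λ q≤o → ≤-trans (m≤n+m∸n m n) (+-monoʳ-≤ n (a≤q+q q≤o))) q≤o
  where
  a q : ℕ
  a = m ∸ n
  q = (a + 1) ℕ./ 2
  a≤q+q : q ≤ o → a ≤ o + o
  a≤q+q q≤o = ≤-trans (s≤s⁻¹ (begin
    1 + a               ≡⟨ +-comm 1 a ⟩
    a + 1               ≡⟨ m≡m%n+[m/n]*n (a + 1) 2 ⟩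
    (a + 1) % 2 + q * 2 ≤⟨ +-monoˡ-≤ (q * 2) (s≤s⁻¹ (m%n<n (a + 1) 2)) ⟩
    1 + q * 2           ≡⟨ cong suc (*-comm q 2) ⟩
    1 + (q + (q + 0))   ≡⟨ cong (λ z → 1 + (q + z)) (+-identityʳ q) ⟩
    1 + (q + q)         ∎)) (+-mono-≤ q≤o q≤o)
    where open ≤-Reasoning
  q≤o : m ≤ n + (o + o) → q ≤ o
  q≤o m≤n+2o = s≤s⁻¹ (m<n*o⇒m/o<n (begin-strict
    a + 1         ≡⟨ +-comm a 1 ⟩
    1 + a         <⟨ s≤s (s≤s (m≤n+o⇒m∸n≤o m n m≤n+2o)) ⟩
    2 + (o + o)   ≡⟨ cong (λ z → 2 + (o + z)) (+-identityʳ o) ⟨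
    2 + 2 * o     ≡⟨ cong (suc ∘ suc) (*-comm 2 o) ⟩
    suc o * 2     ∎))
    where open ≤-Reasoning

^v∣*²⇔^expo∣ : ∀ {p} → Prime p → ∀ n r x → .{{_ : NonZero n}} → .{{_ : NonZero x}} →
               p ^ v p r ∣ n * (x * x) ⇔ p ^ expo n r p ∣ x
^v∣*²⇔^expo∣ {p} p-pr n r x = begin
  p ^ v p r ∣ n * (x * x)           ∼⟨ ^∣⇔≤v p-pr (n * (x * x)) {{m*n≢0 n (x * x)}} ⟩
  v p r ≤ v p (n * (x * x))         ≡⟨ cong (v p r ≤_) v[nx²] ⟩
  v p r ≤ v p n + (v p x + v p x)   ∼⟨ ⇔.sym ([m∸n+1]/2≤o⇔m≤n+[o+o] (v p r) (v p n) (v p x)) ⟩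
  expo n r p ≤ v p x                ∼⟨ ⇔.sym (^∣⇔≤v p-pr x) ⟩
  p ^ expo n r p ∣ x                ∎
  where
  open EquationalReasoning
  instance
    x²≢0 : NonZero (x * x)
    x²≢0 = m*n≢0 x x
  v[nx²] : v p (n * (x * x)) ≡ v p n + (v p x + v p x)
  v[nx²] = trans (v-* p-pr n (x * x)) (cong (λ e → v p n + e) (v-* p-pr x x))

∣*²⇔primeProd∣ : ∀ n r x → .{{_ : NonZero n}} → .{{_ : NonZero r}} → .{{_ : NonZero x}} →
                 r ∣ n * (x * x) ⇔ primeProd n r ∣ x
∣*²⇔primeProd∣ n r x = mk⇔
  (λ r∣nx² → ∣-byPrimePowers (primeProd n r) {{primeProd-nonZero n r}} λ k p-pr p^k∣Π →
    ∣-trans (prime^∣primeProd⇒∣^expo n r k p-pr p^k∣Π)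
            (Equivalence.to (^v∣*²⇔^expo∣ p-pr n r x) (∣-trans (^v∣ p-pr r) r∣nx²)))
  (λ Π∣x → ∣-byPrimePowers r λ k p-pr p^k∣r →
    ∣-trans (^-monoʳ-∣ _ {k} (^∣⇒≤v p-pr r p^k∣r))
            (Equivalence.from (^v∣*²⇔^expo∣ p-pr n r x) (∣-trans (^expo∣primeProd n r p-pr) Π∣x)))

-- Fractions

toℚᵘ-/ : ∀ a b → toℚᵘ (+ a / suc b) ≃ᵘ mkℚᵘ (+ a) b
toℚᵘ-/ a b = ℚP.toℚᵘ-fromℚᵘ (mkℚᵘ (+ a) b)

/≤/⇔ : ∀ a b c e → (+ a / suc b ℚ.≤ + c / suc e) ⇔ (a * suc e ≤ c * suc b)
/≤/⇔ a b c e = mk⇔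
  (λ a/b≤c/e → drop (ℚᵘP.≤-respˡ-≃ (toℚᵘ-/ a b) (ℚᵘP.≤-respʳ-≃ (toℚᵘ-/ c e) (ℚP.toℚᵘ-mono-≤ a/b≤c/e))))
  (λ ae≤cb → ℚP.toℚᵘ-cancel-≤ (ℚᵘP.≤-respˡ-≃ (ℚᵘP.≃-sym (toℚᵘ-/ a b))
    (ℚᵘP.≤-respʳ-≃ (ℚᵘP.≃-sym (toℚᵘ-/ c e)) (*≤* (subst₂ ℤ._≤_ ae≡ cb≡ (ℤ.+≤+ ae≤cb))))))
  where
  ae≡ : + (a * suc e) ≡ + a ℤ.* + suc e
  ae≡ = ℤP.pos-* a (suc e)
  cb≡ : + (c * suc b) ≡ + c ℤ.* + suc b
  cb≡ = ℤP.pos-* c (suc b)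
  drop : mkℚᵘ (+ a) b ℚᵘ.≤ mkℚᵘ (+ c) e → a * suc e ≤ c * suc b
  drop (*≤* ae≤cb) = ℤP.drop‿+≤+ (subst₂ ℤ._≤_ (sym ae≡) (sym cb≡) ae≤cb)

/</⇔ : ∀ a b c e → (+ a / suc b ℚ.< + c / suc e) ⇔ (a * suc e < c * suc b)
/</⇔ a b c e = mk⇔
  (λ a/b<c/e → drop (ℚᵘP.<-respˡ-≃ (toℚᵘ-/ a b) (ℚᵘP.<-respʳ-≃ (toℚᵘ-/ c e) (ℚP.toℚᵘ-mono-< a/b<c/e))))
  (λ ae<cb → ℚP.toℚᵘ-cancel-< (ℚᵘP.<-respˡ-≃ (ℚᵘP.≃-sym (toℚᵘ-/ a b))
    (ℚᵘP.<-respʳ-≃ (ℚᵘP.≃-sym (toℚᵘ-/ c e)) (*<* (subst₂ ℤ._<_ ae≡ cb≡ (ℤ.+<+ ae<cb))))))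
  where
  ae≡ : + (a * suc e) ≡ + a ℤ.* + suc e
  ae≡ = ℤP.pos-* a (suc e)
  cb≡ : + (c * suc b) ≡ + c ℤ.* + suc b
  cb≡ = ℤP.pos-* c (suc b)
  drop : mkℚᵘ (+ a) b ℚᵘ.< mkℚᵘ (+ c) e → a * suc e < c * suc b
  drop (*<* ae<cb) = ℤP.drop‿+<+ (subst₂ ℤ._<_ (sym ae≡) (sym cb≡) ae<cb)

1/≤/⇔ : ∀ b c e → (+ 1 / suc b ℚ.≤ + c / suc e) ⇔ (suc e ≤ c * suc b)
1/≤/⇔ b c e =
  subst (λ m → (+ 1 / suc b ℚ.≤ + c / suc e) ⇔ (m ≤ c * suc b)) (*-identityˡ (suc e)) (/≤/⇔ 1 b c e)

/<1/⇔ : ∀ a b e → (+ a / suc b ℚ.< + 1 / suc e) ⇔ (a * suc e < suc b)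
/<1/⇔ a b e =
  subst (λ m → (+ a / suc b ℚ.< + 1 / suc e) ⇔ (a * suc e < m)) (*-identityˡ (suc b)) (/</⇔ a b 1 e)

[i-j≡k-l]⇒[i≡j⇔k≡l] : ∀ {i j k l : ℤ} → i - j ≡ k - l → (i ≡ j) ⇔ (k ≡ l)
[i-j≡k-l]⇒[i≡j⇔k≡l] {i} {j} {k} {l} i-j≡k-l = mk⇔
  (λ i≡j → ℤP.i-j≡0⇒i≡j k l (trans (sym i-j≡k-l) (ℤP.i≡j⇒i-j≡0 i≡j)))
  (λ k≡l → ℤP.i-j≡0⇒i≡j i j (trans i-j≡k-l (ℤP.i≡j⇒i-j≡0 k≡l)))

+m≡+n-+o⇔m+o≡n : ∀ m n o → (+ m ≡ + n - + o) ⇔ (m + o ≡ n)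
+m≡+n-+o⇔m+o≡n m n o = ⇔.trans ([i-j≡k-l]⇒[i≡j⇔k≡l] (identity (+ m) (+ n) (+ o)))
  (subst (λ i → (i ≡ + n) ⇔ (m + o ≡ n)) (ℤP.pos-+ m o) (mk⇔ ℤP.+-injective (cong (λ a → + a))))
  where
  identity : ∀ i j k → i - (j - k) ≡ (i ℤ.+ k) - j
  identity = solve-∀

/-1/≡1/⇔ : ∀ n d x y → (+ n / suc d ℚ.- + 1 / suc x ≡ + 1 / suc y) ⇔
                        (n * suc x * suc y ≡ suc d * suc y + suc d * suc x)
/-1/≡1/⇔ n d x y = ⇔.trans ≡⇔cross (⇔.trans cross⇔cleared (⇔.sym ℕ⇔ℤ))
  where
  N D X Y : ℤ
  N = + n
  D = + suc d
  X = + suc x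
  Y = + suc y
  Cross : Set
  Cross = (N ℤ.* X ℤ.+ ℤ.- (+ 1) ℤ.* D) ℤ.* Y ≡ + 1 ℤ.* (D ℤ.* X)
  difference≃ : toℚᵘ (+ n / suc d ℚ.- + 1 / suc x) ≃ᵘ mkℚᵘ N d ℚᵘ.- mkℚᵘ (+ 1) x
  difference≃ = ℚᵘP.≃-trans (ℚP.toℚᵘ-homo-+ (+ n / suc d) (ℚ.- (+ 1 / suc x)))
    (ℚᵘP.+-cong (toℚᵘ-/ n d) (ℚᵘP.≃-trans (ℚP.toℚᵘ-homo‿- (+ 1 / suc x)) (ℚᵘP.-‿cong (toℚᵘ-/ 1 x))))
  drop : mkℚᵘ N d ℚᵘ.- mkℚᵘ (+ 1) x ≃ᵘ mkℚᵘ (+ 1) y → Cross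
  drop (*≡* cross) = cross
  ≡⇔cross : (+ n / suc d ℚ.- + 1 / suc x ≡ + 1 / suc y) ⇔ Cross
  ≡⇔cross = mk⇔
    (λ eq → drop (ℚᵘP.≃-trans (ℚᵘP.≃-sym difference≃) (ℚᵘP.≃-trans (ℚP.toℚᵘ-cong eq) (toℚᵘ-/ 1 y))))
    (λ cross → ℚP.toℚᵘ-injective
      (ℚᵘP.≃-trans difference≃ (ℚᵘP.≃-trans (*≡* cross) (ℚᵘP.≃-sym (toℚᵘ-/ 1 y)))))
  identity : ∀ N X Y D → N ℤ.* X ℤ.* Y - (D ℤ.* Y ℤ.+ D ℤ.* X) ≡
                         (N ℤ.* X ℤ.+ ℤ.- (+ 1) ℤ.* D) ℤ.* Y - + 1 ℤ.* (D ℤ.* X)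
  identity = solve-∀
  cross⇔cleared : Cross ⇔ (N ℤ.* X ℤ.* Y ≡ D ℤ.* Y ℤ.+ D ℤ.* X)
  cross⇔cleared = ⇔.sym ([i-j≡k-l]⇒[i≡j⇔k≡l] (identity N X Y D))
  ℕ⇔ℤ : (n * suc x * suc y ≡ suc d * suc y + suc d * suc x) ⇔ (N ℤ.* X ℤ.* Y ≡ D ℤ.* Y ℤ.+ D ℤ.* X)
  ℕ⇔ℤ = subst ((n * suc x * suc y ≡ suc d * suc y + suc d * suc x) ⇔_)
    (cong₂ _≡_ (trans (ℤP.pos-* (n * suc x) (suc y)) (cong (ℤ._* Y) (ℤP.pos-* n (suc x))))
               (trans (ℤP.pos-+ (suc d * suc y) (suc d * suc x))
                      (cong₂ ℤ._+_ (ℤP.pos-* (suc d) (suc y)) (ℤP.pos-* (suc d) (suc x)))))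
    (mk⇔ (cong (λ m → + m)) ℤP.+-injective)

0<1/suc : ∀ m → 0ℚ ℚ.< + 1 / suc m
0<1/suc m = Equivalence.from (/</⇔ 0 0 1 m) (s≤s z≤n)

1/suc≤1 : ∀ m → + 1 / suc m ℚ.≤ 1ℚ
1/suc≤1 m = Equivalence.from (/≤/⇔ 1 m 1 0) (s≤s z≤n)

1/[3+2k]<1/[1+2k] : ∀ k → + 1 / (3 + 2 * k) ℚ.< + 1 / (1 + 2 * k)
1/[3+2k]<1/[1+2k] k = Equivalence.from (/<1/⇔ 1 (2 + 2 * k) (2 * k))
  (subst (_< 3 + 2 * k) (sym (*-identityˡ _)) (s≤s (s≤s (n≤1+n (2 * k)))))

-- The odd greedy algorithm

-- 1/x ≤ n/d < 1/(x − 2) with denominators cleared. For x = 1 the upper bound holds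
-- trivially, in accordance with the rule x = 1 when n/d ≥ 1.
GreedyBounds : ℕ → ℕ → ℕ → Set
GreedyBounds n d x = d ≤ n * x × n * x < d + 2 * n

greedyBounds[1]⇔ : ∀ n d → GreedyBounds n (suc d) 1 ⇔ 1ℚ ℚ.≤ + n / suc d
greedyBounds[1]⇔ n d = mk⇔
  (λ (d≤n , _) → Equivalence.from (1/≤/⇔ 0 n d) d≤n)
  (λ 1≤n/d → Equivalence.to (1/≤/⇔ 0 n d) 1≤n/d , n<d+2n)
  where
  n<d+2n : n * 1 < suc d + 2 * n
  n<d+2n = ≤-<-trans (≤-trans (≤-reflexive (*-identityʳ n)) (m≤m+n n (n + 0))) (s≤s (m≤n+m (2 * n) d))

greedyBounds[3+2k]⇔ : ∀ n d k → GreedyBounds n (suc d) (3 + 2 * k) ⇔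
                       (+ 1 / (3 + 2 * k) ℚ.≤ + n / suc d × + n / suc d ℚ.< + 1 / (1 + 2 * k))
greedyBounds[3+2k]⇔ n d k =
  ⇔.sym (1/≤/⇔ (2 + 2 * k) n d) ×-⇔ ⇔.trans shift (⇔.sym (/<1/⇔ n d (2 * k)))
  where
  nx≡n[x-2]+2n : n * (3 + 2 * k) ≡ n * (1 + 2 * k) + 2 * n
  nx≡n[x-2]+2n = begin
    n * (2 + (1 + 2 * k))     ≡⟨ *-distribˡ-+ n 2 (1 + 2 * k) ⟩
    n * 2 + n * (1 + 2 * k)   ≡⟨ +-comm (n * 2) _ ⟩
    n * (1 + 2 * k) + n * 2   ≡⟨ cong (λ m → n * (1 + 2 * k) + m) (*-comm n 2) ⟩
    n * (1 + 2 * k) + 2 * n   ∎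
    where open ≡-Reasoning
  shift : n * (3 + 2 * k) < suc d + 2 * n ⇔ n * (1 + 2 * k) < suc d
  shift = mk⇔ (λ lt → +-cancelʳ-< (2 * n) _ _ (subst (_< suc d + 2 * n) nx≡n[x-2]+2n lt))
              (λ lt → subst (_< suc d + 2 * n) (sym nx≡n[x-2]+2n) (+-monoˡ-< (2 * n) lt))

greedyStep⇒0< : ∀ {R R′} → GreedyStep R R′ → 0ℚ ℚ.< R
greedyStep⇒0< (big 1≤R)           = ℚP.<-≤-trans (0<1/suc 0) 1≤R
greedyStep⇒0< (small _ 0<R _ _ _) = 0<R

OGLength-step : ∀ {R R′ ℓ} → GreedyStep R R′ → OGLength R′ ℓ → OGLength R (suc ℓ)
OGLength-step R→R′ = step (greedyStep⇒0< R→R′) R→R′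

OGLength-R-R : ∀ R → OGLength (R ℚ.- R) 0
OGLength-R-R R = subst (λ R′ → OGLength R′ 0) (sym (ℚP.+-inverseʳ R)) done

greedyStep⇒oddUnit : ∀ {R R′} → GreedyStep R R′ → ∃ λ k → R′ ≡ R ℚ.- + 1 / (1 + 2 * k)
greedyStep⇒oddUnit (big _) = 0 , refl
greedyStep⇒oddUnit {R} (small k _ _ _ _) = suc k , cong (λ m → R ℚ.- + 1 / suc m) (sym (*-suc 2 k))

OGLength-oddUnit : ∀ k → OGLength (+ 1 / (1 + 2 * k)) 1
OGLength-oddUnit zero = OGLength-step (big ℚP.≤-refl) (OGLength-R-R 1ℚ)
OGLength-oddUnit (suc k) = subst (λ m → OGLength (+ 1 / suc m) 1) (sym (*-suc 2 k))
  (OGLength-step (small k (0<1/suc (2 + 2 * k)) 1/x<1 ℚP.≤-refl (1/[3+2k]<1/[1+2k] k))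
    (OGLength-R-R (+ 1 / (3 + 2 * k))))
  where
  1/x<1 : + 1 / (3 + 2 * k) ℚ.< 1ℚ
  1/x<1 = ℚP.<-≤-trans (1/[3+2k]<1/[1+2k] k) (1/suc≤1 (2 * k))

OGLength-1⇔oddUnit : ∀ {R} → OGLength R 1 ⇔ ∃ λ k → R ≡ + 1 / (1 + 2 * k)
OGLength-1⇔oddUnit {R} =
  mk⇔ to (λ (k , R≡1/x) → subst (λ R → OGLength R 1) (sym R≡1/x) (OGLength-oddUnit k))
  where
  to : OGLength R 1 → ∃ λ k → R ≡ + 1 / (1 + 2 * k)
  to (step _ R→0 done) with greedyStep⇒oddUnit R→0
  ... | k , 0≡R-1/x = k , x∙y⁻¹≈ε⇒x≈y R _ (sym 0≡R-1/x)

greedyStep[/]⇒ : ∀ n d {R′} → GreedyStep (+ n / suc d) R′ →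
                 ∃ λ k → GreedyBounds n (suc d) (1 + 2 * k) × R′ ≡ + n / suc d ℚ.- + 1 / (1 + 2 * k)
greedyStep[/]⇒ n d (big 1≤n/d) = 0 , Equivalence.from (greedyBounds[1]⇔ n d) 1≤n/d , refl
greedyStep[/]⇒ n d {R′} (small k _ _ 1/x≤n/d n/d<1/[x-2]) =
  suc k , subst (λ m → GreedyBounds n (suc d) (suc m) × R′ ≡ + n / suc d ℚ.- + 1 / suc m)
                (sym (*-suc 2 k))
                (Equivalence.from (greedyBounds[3+2k]⇔ n d k) (1/x≤n/d , n/d<1/[x-2]) , refl)

greedyStep[/]⇐ : ∀ n d k → GreedyBounds n (suc d) (1 + 2 * k) →
                 GreedyStep (+ n / suc d) (+ n / suc d ℚ.- + 1 / (1 + 2 * k))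
greedyStep[/]⇐ n d zero bounds = big (Equivalence.to (greedyBounds[1]⇔ n d) bounds)
greedyStep[/]⇐ n d (suc k) bounds
  with Equivalence.to (greedyBounds[3+2k]⇔ n d k)
         (subst (λ m → GreedyBounds n (suc d) (suc m)) (*-suc 2 k) bounds)
... | 1/x≤n/d , n/d<1/[x-2] =
  subst (λ m → GreedyStep (+ n / suc d) (+ n / suc d ℚ.- + 1 / suc m)) (sym (*-suc 2 k))
    (small k (ℚP.<-≤-trans (0<1/suc (2 + 2 * k)) 1/x≤n/d)
             (ℚP.<-≤-trans n/d<1/[x-2] (1/suc≤1 (2 * k))) 1/x≤n/d n/d<1/[x-2])

OddGreedyPair : ℕ → ℕ → ℕ → ℕ → Set
OddGreedyPair n d x y = Odd x × Odd y × GreedyBounds n d x × n * x * y ≡ d * y + d * x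

OGLength-2⇔oddGreedyPair : ∀ n d → OGLength (+ n / suc d) 2 ⇔ ∃₂ λ x y → OddGreedyPair n (suc d) x y
OGLength-2⇔oddGreedyPair n d = mk⇔ to from
  where
  to : OGLength (+ n / suc d) 2 → ∃₂ λ x y → OddGreedyPair n (suc d) x y
  to (step _ first rest) with greedyStep[/]⇒ n d first
  ... | k , bounds , R′≡n/d-1/x
    with Equivalence.to OGLength-1⇔oddUnit (subst (λ R → OGLength R 1) R′≡n/d-1/x rest)
  ...   | l , n/d-1/x≡1/y = 1 + 2 * k , 1 + 2 * l , (k , refl) , (l , refl) , bounds ,
                            Equivalence.to (/-1/≡1/⇔ n d (2 * k) (2 * l)) n/d-1/x≡1/y
  from : (∃₂ λ x y → OddGreedyPair n (suc d) x y) → OGLength (+ n / suc d) 2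
  from (_ , _ , (k , refl) , (l , refl) , bounds , nxy≡dy+dx) =
    OGLength-step (greedyStep[/]⇐ n d k bounds)
      (subst (λ R → OGLength R 1) (sym (Equivalence.from (/-1/≡1/⇔ n d (2 * k) (2 * l)) nxy≡dy+dx))
        (OGLength-oddUnit l))

-- With d + r = nx, the remainder n/d − 1/x is r/(dx), and dx ≡ nx² modulo r.
unitRemainder⇔ : ∀ {n d r x} → d + r ≡ n * x → Odd d → Odd x →
                 (∃ λ y → Odd y × n * x * y ≡ d * y + d * x) ⇔ r ∣ n * (x * x)
unitRemainder⇔ {n} {d} {r} {x} d+r≡nx odd-d odd-x = mk⇔ to from
  where
  nx²≡rx+dx : n * (x * x) ≡ r * x + d * x
  nx²≡rx+dx = begin
    n * (x * x)   ≡⟨ *-assoc n x x ⟨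
    n * x * x     ≡⟨ cong (_* x) d+r≡nx ⟨
    (d + r) * x   ≡⟨ *-distribʳ-+ x d r ⟩
    d * x + r * x ≡⟨ +-comm (d * x) (r * x) ⟩
    r * x + d * x ∎
    where open ≡-Reasoning
  to : (∃ λ y → Odd y × n * x * y ≡ d * y + d * x) → r ∣ n * (x * x)
  to (y , _ , nxy≡dy+dx) = subst (r ∣_) (sym nx²≡rx+dx) (∣m∣n⇒∣m+n (m∣m*n x) (divides y dx≡yr))
    where
    dx≡yr : d * x ≡ y * r
    dx≡yr = sym (+-cancelˡ-≡ (d * y) (y * r) (d * x) (begin
      d * y + y * r ≡⟨ cong (λ z → d * y + z) (*-comm y r) ⟩
      d * y + r * y ≡⟨ *-distribʳ-+ y d r ⟨
      (d + r) * y   ≡⟨ cong (_* y) d+r≡nx ⟩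
      n * x * y     ≡⟨ nxy≡dy+dx ⟩
      d * y + d * x ∎))
      where open ≡-Reasoning
  from : r ∣ n * (x * x) → ∃ λ y → Odd y × n * x * y ≡ d * y + d * x
  from r∣nx² with ∣m+n∣m⇒∣n (subst (r ∣_) nx²≡rx+dx r∣nx²) (m∣m*n x)
  ... | divides y dx≡yr = y , odd-*⇒oddˡ y r (subst Odd dx≡yr (odd-* odd-d odd-x)) , (begin
    n * x * y     ≡⟨ cong (_* y) d+r≡nx ⟨
    (d + r) * y   ≡⟨ *-distribʳ-+ y d r ⟩
    d * y + r * y ≡⟨ cong (λ z → d * y + z) (trans (*-comm r y) (sym dx≡yr)) ⟩
    d * y + d * x ∎)
    where open ≡-Reasoning

oddGreedyPair⇔ : ∀ n d → .{{_ : NonZero n}} → Even n → Odd d →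
                 (∃₂ λ x y → OddGreedyPair n d x y) ⇔
                 (∃₂ λ r t → Odd r × r < 2 * n × + d ≡ + (n * primeProd n r * (1 + 2 * t)) - + r)
oddGreedyPair⇔ n d even-n odd-d = mk⇔ to from
  where
  to : (∃₂ λ x y → OddGreedyPair n d x y) →
       ∃₂ λ r t → Odd r × r < 2 * n × + d ≡ + (n * primeProd n r * (1 + 2 * t)) - + r
  to (x , y , odd-x , odd-y , (d≤nx , nx<d+2n) , nxy≡dy+dx) = r , t , odd-r , r<2n , d≡nPm-r
    where
    r : ℕ
    r = n * x ∸ d
    d+r≡nx : d + r ≡ n * x
    d+r≡nx = m+[n∸m]≡n d≤nx
    r<2n : r < 2 * n
    r<2n = m<n+o⇒m∸n<o (n * x) d {{m*n≢0 2 n}} nx<d+2n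
    odd-r : Odd r
    odd-r = odd∧2∣+⇒odd odd-d (subst (2 ∣_) (sym d+r≡nx) (∣m⇒∣m*n x (even⇒2∣ even-n)))
    instance
      r≢0 : NonZero r
      r≢0 = odd⇒nonZero odd-r
      x≢0 : NonZero x
      x≢0 = odd⇒nonZero odd-x
    P∣x : primeProd n r ∣ x
    P∣x = Equivalence.to (∣*²⇔primeProd∣ n r x)
            (Equivalence.to (unitRemainder⇔ {n} d+r≡nx odd-d odd-x) (y , odd-y , nxy≡dy+dx))
    m : ℕ
    m = quotient P∣x
    odd-m : Odd m
    odd-m = odd-*⇒oddˡ m (primeProd n r) (subst Odd (_∣_.equality P∣x) odd-x)
    t : ℕ
    t = proj₁ odd-m
    d≡nPm-r : + d ≡ + (n * primeProd n r * (1 + 2 * t)) - + r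
    d≡nPm-r = Equivalence.from (+m≡+n-+o⇔m+o≡n d _ r) (begin
      d + r                             ≡⟨ d+r≡nx ⟩
      n * x                             ≡⟨ cong (n *_) (_∣_.equality P∣x) ⟩
      n * (m * primeProd n r)           ≡⟨ cong (λ k → n * (k * primeProd n r)) (proj₂ odd-m) ⟩
      n * ((1 + 2 * t) * primeProd n r) ≡⟨ cong (n *_) (*-comm (1 + 2 * t) (primeProd n r)) ⟩
      n * (primeProd n r * (1 + 2 * t)) ≡⟨ *-assoc n (primeProd n r) (1 + 2 * t) ⟨
      n * primeProd n r * (1 + 2 * t)   ∎)
      where open ≡-Reasoning
  from : (∃₂ λ r t → Odd r × r < 2 * n × + d ≡ + (n * primeProd n r * (1 + 2 * t)) - + r) →
         ∃₂ λ x y → OddGreedyPair n d x y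
  from (r , t , odd-r , r<2n , d≡nPm-r) =
    extend (Equivalence.from (unitRemainder⇔ {n} d+r≡nx odd-d odd-x) r∣nx²)
    where
    x : ℕ
    x = primeProd n r * (1 + 2 * t)
    odd-x : Odd x
    odd-x = odd-* (primeProd-odd n odd-r) (t , refl)
    d+r≡nx : d + r ≡ n * x
    d+r≡nx = trans (Equivalence.to (+m≡+n-+o⇔m+o≡n d _ r) d≡nPm-r) (*-assoc n (primeProd n r) (1 + 2 * t))
    instance
      r≢0 : NonZero r
      r≢0 = odd⇒nonZero odd-r
      x≢0 : NonZero x
      x≢0 = odd⇒nonZero odd-x
    r∣nx² : r ∣ n * (x * x)
    r∣nx² = Equivalence.from (∣*²⇔primeProd∣ n r x)
              (divides (1 + 2 * t) (*-comm (primeProd n r) (1 + 2 * t)))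
    extend : (∃ λ y → Odd y × n * x * y ≡ d * y + d * x) → ∃₂ λ x y → OddGreedyPair n d x y
    extend (y , odd-y , nxy≡dy+dx) =
      x , y , odd-x , odd-y ,
      (subst (d ≤_) d+r≡nx (m≤m+n d r) , subst (_< d + 2 * n) d+r≡nx (+-monoʳ-< d r<2n)) ,
      nxy≡dy+dx

proposition2p2 : (n : ℕ) → .{{_ : NonZero n}} → Even n →
    (d : ℕ) → .{{_ : NonZero d}} → Odd d →
    (OGLength (+ n / d) 2 ⇔
      ∃₂ λ r t → Odd r × r < 2 * n ×
        (+ d ≡ + (n * primeProd n r * (1 + 2 * t)) - + r))
proposition2p2 n even-n .(1 + 2 * j) odd-d@(j , refl) =
  ⇔.trans (OGLength-2⇔oddGreedyPair n (2 * j)) (oddGreedyPair⇔ n (1 + 2 * j) even-n odd-d)
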